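{- Let $n\ge 3$, let $G$ be a bipartite graph and $H$ a non-bipartite graph, both on $n$ vertices. Suppose there are $m\ge \frac{5n}{6}+2$ distinct vertices $v_1,\dots,v_m$ of $G$ and distinct vertices $w_1,\dots,w_m$ of $H$ with $G-v_i\cong H-w_i$ for all $i$. Then $G$ and $H$ have the same number of edges.
   Context: All graphs are finite and simple. For a graph $X$ and vertex $v$, $X-v$ denotes the graph obtained by deleting $v$ and its incident edges. -}

module Defs where

open import Data.Nat using (ℕ; zero; suc; _+_; _*_; _<_; _<ᵇ_)
open import Data.Bool using (Bool; true; false; _∧_; if_then_else_; T)
open import Data.Fin using (Fin; toℕ; punchIn)
open import Data.Nat.ListAction using (sum)
open import Data.List using (List; map; allFin; concatMap; length; filter)
open import Data.Product using (Σ; _×_; _,_)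
open import Relation.Binary.PropositionalEquality using (_≡_; _≢_)
open import Relation.Nullary using (¬_)
open import Function.Bundles using (_↔_; Inverse)

record Graph (n : ℕ) : Set where
  field
    adj   : Fin n → Fin n → Bool
    sym   : ∀ i j → adj i j ≡ adj j i
    irrfl : ∀ i → adj i i ≡ false
open Graph public

edgeCount : ∀ {n} → Graph n → ℕ
edgeCount {n} X =
  sum (map (λ i → sum (map (λ j → if (toℕ i <ᵇ toℕ j) ∧ adj X i j then 1 else 0)
                           (allFin n)))
           (allFin n))

Bipartite : ∀ {n} → Graph n → Set
Bipartite {n} X = Σ (Fin n → Bool) λ c → ∀ i j → T (adj X i j) → c i ≢ c j

delete : ∀ {n} → Graph (suc n) → Fin (suc n) → Graph n
delete X v = record
  { adj   = λ i j → adj X (punchIn v i) (punchIn v j)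
  ; sym   = λ i j → sym X (punchIn v i) (punchIn v j)
  ; irrfl = λ i → irrfl X (punchIn v i)
  }

_≅_ : ∀ {n} → Graph n → Graph n → Set
_≅_ {n} X Y = Σ (Fin n ↔ Fin n) λ f →
  ∀ i j → adj X i j ≡ adj Y (Inverse.to f i) (Inverse.to f j)

module Submission where

-- Since H is not bipartite it has an odd closed walk; shortcutting it as long as possible gives
-- one, C, without backtracking and with no vertex having three neighbours on C (one of the three
-- arcs between them would close up to a shorter odd walk), so every vertex of C has exactly two
-- neighbours on C. Each w i lies on C, for otherwise
-- C would survive in H - w i ≅ G - v i, which is bipartite. Hence the r vertices off C satisfy
-- 5r + 12 ≤ m, and double counting the edges leaving C shows that at most 3r vertices of H have
-- degree different from 2.
-- Deleting v i and w i gives e(G) + deg w i = e(H) + deg v i. If e(G) ≠ e(H), some w i₀ has degree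
-- 2 (at most 2r of the w i do not), so a = deg v i₀ ≠ 2 and deg v j = a whenever deg w j = 2. In
-- G - v i₀ ≅ H - w i₀ such a v j keeps a degree ≠ 2 unless a = 3 and v j ∼ v i₀, so at most
-- (3r + 2) + 3 of them besides i₀ exist; then m ≤ 5r + 6, a contradiction.

open import Defs hiding (sym)
open import Data.Bool using (Bool; true; false; if_then_else_; _∧_; _∨_; not; _xor_; T; T?)
  renaming (_≟_ to _≟𝔹_)
open import Data.Bool.Properties
  using (T-≡; T-∧; T-∨; not-involutive; ¬-not; not-¬; not-distribˡ-xor; xor-same; xor-comm; xor-identityʳ)
open import Data.Empty using (⊥; ⊥-elim)
open import Data.Fin using (Fin; zero; suc; toℕ; fromℕ<; punchIn; punchOut; _≟_)
open import Data.Fin.Properties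
  using (any?; toℕ<n; toℕ-injective; toℕ-fromℕ<; suc-injective;
         punchIn-injective; punchOut-injective; punchIn-punchOut)
open import Data.List using (map; tabulate)
import Data.Nat.ListAction as List
open import Data.Nat
  using (ℕ; zero; suc; NonZero; >-nonZero; _+_; _*_; _∸_; _≤_; _<_; z≤n; s≤s; _<ᵇ_; _<?_)
  renaming (_≟_ to _≟ℕ_)
open import Data.Nat.DivMod
  using (_%_; _/_; m≡m%n+[m/n]*n; [m+kn]%n≡m%n; [m+n]%n≡m%n; m%n<n; m<n⇒m%n≡m; n%n≡0)
open import Data.Nat.Properties hiding (suc-injective; _≟_)
open import Data.Nat.Tactic.RingSolver using (solve-∀)
open import Algebra.Properties.CommutativeSemigroup +-commutativeSemigroup using (xy∙z≈xz∙y)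
open import Algebra.Properties.CommutativeMonoid.Sum +-0-commutativeMonoid
  using (sum; sum-remove; ∑-comm; sum-permute; sum-cong-≗; ∑-distrib-+)
open import Data.Product using (Σ; ∃; _×_; _,_; proj₁; proj₂)
open import Data.Sum using (_⊎_; inj₁; inj₂)
open import Data.Unit using (tt)
open import Function.Bundles using (Inverse; Equivalence)
open import Function.Base using (_∘_)
open import Function.Definitions using (Injective)
open import Relation.Binary.Definitions using (tri<; tri≈; tri>)
open import Relation.Binary.PropositionalEquality hiding ([_])
open import Relation.Nullary using (¬_; Dec; yes; no)
open import Relation.Nullary.Decidable
  using (_×-dec_; decidable-stable; isYes; isNo; toWitness; fromWitness; toWitnessFalse; fromWitnessFalse)

∧-proj₁ : ∀ {a b} → T (a ∧ b) → T a
∧-proj₁ = proj₁ ∘ Equivalence.to T-∧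

∧-proj₂ : ∀ {a b} → T (a ∧ b) → T b
∧-proj₂ = proj₂ ∘ Equivalence.to T-∧

∧-intro : ∀ {a b} → T a → T b → T (a ∧ b)
∧-intro Ta Tb = Equivalence.from T-∧ (Ta , Tb)

[_] : Bool → ℕ
[ b ] = if b then 1 else 0

count : ∀ {k} → (Fin k → Bool) → ℕ
count P = sum (λ i → [ P i ])

sum-mono-≤ : ∀ {k} (f g : Fin k → ℕ) → (∀ i → f i ≤ g i) → sum f ≤ sum g
sum-mono-≤ {zero} f g f≤g = z≤n
sum-mono-≤ {suc k} f g f≤g =
  +-mono-≤ (f≤g zero) (sum-mono-≤ (λ i → f (suc i)) (λ i → g (suc i)) (λ i → f≤g (suc i)))

[]-mono : ∀ {a b} → (T a → T b) → [ a ] ≤ [ b ]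
[]-mono {false} a⇒b = z≤n
[]-mono {true} {true} a⇒b = ≤-refl
[]-mono {true} {false} a⇒b = ⊥-elim (a⇒b tt)

count-mono : ∀ {k} (P Q : Fin k → Bool) → (∀ i → T (P i) → T (Q i)) → count P ≤ count Q
count-mono P Q P⇒Q = sum-mono-≤ _ _ (λ i → []-mono (P⇒Q i))

count-true : ∀ k → count {k} (λ _ → true) ≡ k
count-true zero = refl
count-true (suc k) = cong suc (count-true k)

[]-split : ∀ a b → [ a ] ≡ [ a ∧ b ] + [ a ∧ not b ]
[]-split false b = refl
[]-split true false = refl
[]-split true true = refl

count-split : ∀ {k} (P Q : Fin k → Bool) →
  count P ≡ count (λ i → P i ∧ Q i) + count (λ i → P i ∧ not (Q i))
count-split P Q = trans (sum-cong-≗ (λ i → []-split (P i) (Q i)))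
  (∑-distrib-+ (λ i → [ P i ∧ Q i ]) (λ i → [ P i ∧ not (Q i) ]))

count+count-not : ∀ {k} (P : Fin k → Bool) → count P + count (λ i → not (P i)) ≡ k
count+count-not {k} P = sym (trans (sym (count-true k)) (count-split (λ _ → true) P))

[]-∨ : ∀ a b → [ a ∨ b ] ≤ [ a ] + [ b ]
[]-∨ false b = ≤-refl
[]-∨ true b = s≤s z≤n

count-∨ : ∀ {k} (P Q : Fin k → Bool) → count (λ i → P i ∨ Q i) ≤ count P + count Q
count-∨ P Q = ≤-trans (sum-mono-≤ _ _ (λ i → []-∨ (P i) (Q i)))
  (≤-reflexive (∑-distrib-+ (λ i → [ P i ]) (λ i → [ Q i ])))

0<count⇒∃ : ∀ {k} (P : Fin k → Bool) → 0 < count P → ∃ λ i → T (P i)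
0<count⇒∃ {suc k} P 0<c with P zero in eq
... | true = zero , subst T (sym eq) tt
... | false = let (i , Pi) = 0<count⇒∃ (λ i → P (suc i)) 0<c in suc i , Pi

count≡0 : ∀ {k} (P : Fin k → Bool) → (∀ i → ¬ T (P i)) → count P ≡ 0
count≡0 {zero} P ¬P = refl
count≡0 {suc k} P ¬P with P zero in eq
... | true = ⊥-elim (¬P zero (subst T (sym eq) tt))
... | false = count≡0 (λ i → P (suc i)) (λ i → ¬P (suc i))

count≤1 : ∀ {k} (P : Fin k → Bool) →
  (∀ i j → toℕ i < toℕ j → T (P i) → T (P j) → ⊥) → count P ≤ 1
count≤1 {zero} P ¬P₂ = z≤n
count≤1 {suc k} P ¬P₂ with P zero in eq
... | true = ≤-reflexive (cong suc (count≡0 (λ i → P (suc i))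
               (λ i → ¬P₂ zero (suc i) (s≤s z≤n) (subst T (sym eq) tt))))
... | false = count≤1 (λ i → P (suc i)) (λ i j lt → ¬P₂ (suc i) (suc j) (s≤s lt))

count≤2 : ∀ {k} (P : Fin k → Bool) →
  (∀ i j l → toℕ i < toℕ j → toℕ j < toℕ l → T (P i) → T (P j) → T (P l) → ⊥) → count P ≤ 2
count≤2 {zero} P ¬P₃ = z≤n
count≤2 {suc k} P ¬P₃ with P zero in eq
... | true = s≤s (count≤1 (λ i → P (suc i))
               (λ i j lt → ¬P₃ zero (suc i) (suc j) (s≤s z≤n) (s≤s lt) (subst T (sym eq) tt)))
... | false = count≤2 (λ i → P (suc i)) (λ i j l lt lt' → ¬P₃ (suc i) (suc j) (suc l) (s≤s lt) (s≤s lt'))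

count-≤-injection : ∀ {a b} (P : Fin a → Bool) (Q : Fin b → Bool) (f : ∀ i → T (P i) → Fin b) →
  (∀ i j p q → f i p ≡ f j q → i ≡ j) → (∀ i p → T (Q (f i p))) → count P ≤ count Q
count-≤-injection {zero} P Q f f-inj f∈Q = z≤n
count-≤-injection {suc a} {b} P Q f f-inj f∈Q with P zero in eq
... | false = count-≤-injection (λ i → P (suc i)) Q (λ i → f (suc i))
                (λ i j p q e → suc-injective (f-inj (suc i) (suc j) p q e)) (λ i → f∈Q (suc i))
... | true = remove-image b Q f f-inj f∈Q (subst T (sym eq) tt)
  where
  remove-image : ∀ b (Q : Fin b → Bool) (f : ∀ i → T (P i) → Fin b) →
    (∀ i j p q → f i p ≡ f j q → i ≡ j) → (∀ i p → T (Q (f i p))) →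
    (p₀ : T (P zero)) → 1 + count (λ i → P (suc i)) ≤ count Q
  remove-image zero Q f f-inj f∈Q p₀ with f zero p₀
  ... | ()
  remove-image (suc b) Q f f-inj f∈Q p₀ = begin
    1 + count (λ i → P (suc i))          ≤⟨ s≤s rest ⟩
    1 + count (λ j → Q (punchIn y₀ j))   ≡⟨ cong (_+ count (λ j → Q (punchIn y₀ j))) (sym Qy₀) ⟩
    [ Q y₀ ] + count (λ j → Q (punchIn y₀ j)) ≡⟨ sum-remove {i = y₀} (λ j → [ Q j ]) ⟨
    count Q                              ∎
    where
    open ≤-Reasoning
    y₀ = f zero p₀
    y₀≢ : ∀ i p → y₀ ≢ f (suc i) p
    y₀≢ i p e with f-inj zero (suc i) p₀ p e
    ... | ()
    rest = count-≤-injection (λ i → P (suc i)) (λ j → Q (punchIn y₀ j))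
             (λ i p → punchOut (y₀≢ i p))
             (λ i j p q e → suc-injective (f-inj (suc i) (suc j) p q
               (punchOut-injective (y₀≢ i p) (y₀≢ j q) e)))
             (λ i p → subst (λ z → T (Q z)) (sym (punchIn-punchOut (y₀≢ i p))) (f∈Q (suc i) p))
    Qy₀ : [ Q y₀ ] ≡ 1
    Qy₀ with Q y₀ | f∈Q zero p₀
    ... | true | _ = refl

2≤count : ∀ {k} (P : Fin k → Bool) (i j : Fin k) → i ≢ j → T (P i) → T (P j) → 2 ≤ count P
2≤count {k} P i j i≢j Pi Pj = count-≤-injection {2} (λ _ → true) P pair pair-inj pair∈P
  where
  pair : Fin 2 → T true → Fin k
  pair zero _ = i
  pair (suc zero) _ = j
  pair-inj : ∀ x y p q → pair x p ≡ pair y q → x ≡ y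
  pair-inj zero zero _ _ _ = refl
  pair-inj zero (suc zero) _ _ e = ⊥-elim (i≢j e)
  pair-inj (suc zero) zero _ _ e = ⊥-elim (i≢j (sym e))
  pair-inj (suc zero) (suc zero) _ _ _ = refl
  pair∈P : ∀ x p → T (P (pair x p))
  pair∈P zero _ = Pi
  pair∈P (suc zero) _ = Pj

deg : ∀ {N} → Graph N → Fin N → ℕ
deg X x = count (adj X x)

edges : ∀ {N} → Graph N → ℕ
edges X = sum (λ i → count (λ j → (toℕ i <ᵇ toℕ j) ∧ adj X i j))

listSum-map-tabulate : ∀ {A : Set} n (g : A → ℕ) (h : Fin n → A) →
  List.sum (map g (tabulate h)) ≡ sum (λ i → g (h i))
listSum-map-tabulate zero g h = refl
listSum-map-tabulate (suc n) g h = cong (g (h zero) +_) (listSum-map-tabulate n g (λ i → h (suc i)))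

edgeCount≡edges : ∀ {N} (X : Graph N) → edgeCount X ≡ edges X
edgeCount≡edges {N} X = trans (listSum-map-tabulate N _ (λ i → i))
  (sum-cong-≗ (λ i → listSum-map-tabulate N (λ j → [ (toℕ i <ᵇ toℕ j) ∧ adj X i j ]) (λ j → j)))

<ᵇ≡true : ∀ {m n} → m < n → (m <ᵇ n) ≡ true
<ᵇ≡true m<n = Equivalence.to T-≡ (<⇒<ᵇ m<n)

<ᵇ≡false : ∀ {m n} → ¬ m < n → (m <ᵇ n) ≡ false
<ᵇ≡false {m} {n} m≮n with m <ᵇ n in eq
... | false = refl
... | true = ⊥-elim (m≮n (<ᵇ⇒< m n (subst T (sym eq) tt)))

[adj]-split : ∀ {N} (X : Graph N) i j →
  [ adj X i j ] ≡ [ (toℕ i <ᵇ toℕ j) ∧ adj X i j ] + [ (toℕ j <ᵇ toℕ i) ∧ adj X j i ]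
[adj]-split X i j with <-cmp (toℕ i) (toℕ j)
... | tri< i<j _ i≯j rewrite <ᵇ≡true i<j | <ᵇ≡false i≯j = sym (+-identityʳ _)
... | tri≈ _ i≡j _ rewrite toℕ-injective i≡j | <ᵇ≡false (<-irrefl {toℕ j} refl) = cong [_] (irrfl X j)
... | tri> i≮j _ i>j rewrite <ᵇ≡false i≮j | <ᵇ≡true i>j = cong [_] (Graph.sym X i j)

handshake : ∀ {N} (X : Graph N) → edges X + edges X ≡ sum (deg X)
handshake X = sym (begin
  sum (λ i → sum (λ j → [ adj X i j ]))
    ≡⟨ sum-cong-≗ (λ i → sum-cong-≗ (λ j → [adj]-split X i j)) ⟩
  sum (λ i → sum (λ j → [ i<j∧adj i j ] + [ i<j∧adj j i ]))
    ≡⟨ sum-cong-≗ (λ i → ∑-distrib-+ (λ j → [ i<j∧adj i j ]) (λ j → [ i<j∧adj j i ])) ⟩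
  sum (λ i → sum (λ j → [ i<j∧adj i j ]) + sum (λ j → [ i<j∧adj j i ]))
    ≡⟨ ∑-distrib-+ (λ i → sum (λ j → [ i<j∧adj i j ])) (λ i → sum (λ j → [ i<j∧adj j i ])) ⟩
  edges X + sum (λ i → sum (λ j → [ i<j∧adj j i ]))
    ≡⟨ cong (edges X +_) (∑-comm (λ i j → [ i<j∧adj j i ])) ⟩
  edges X + edges X ∎)
  where
  open ≡-Reasoning
  i<j∧adj : _ → _ → Bool
  i<j∧adj i j = (toℕ i <ᵇ toℕ j) ∧ adj X i j

deg-punchIn : ∀ {n} (X : Graph (suc n)) (v x : Fin (suc n)) →
  deg X x ≡ [ adj X x v ] + count (λ q → adj X x (punchIn v q))
deg-punchIn X v x = sum-remove {i = v} (λ j → [ adj X x j ])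

deg-delete : ∀ {n} (X : Graph (suc n)) (v : Fin (suc n)) (p : Fin n) →
  deg X (punchIn v p) ≡ [ adj X (punchIn v p) v ] + deg (delete X v) p
deg-delete X v p = deg-punchIn X v (punchIn v p)

double-injective : ∀ a b → a + a ≡ b + b → a ≡ b
double-injective a b e =
  *-cancelˡ-≡ a b 2 (trans (cong (a +_) (+-identityʳ a)) (trans e (cong (b +_) (sym (+-identityʳ b)))))

edges-delete : ∀ {n} (X : Graph (suc n)) (v : Fin (suc n)) → edges X ≡ edges (delete X v) + deg X v
edges-delete X v = double-injective _ _ (begin
  edges X + edges X                                      ≡⟨ handshake X ⟩
  sum (deg X)                                            ≡⟨ sum-remove {i = v} (deg X) ⟩
  deg X v + sum (λ p → deg X (punchIn v p))
    ≡⟨ cong (deg X v +_) (sum-cong-≗ (deg-delete X v)) ⟩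
  deg X v + sum (λ p → [ adj X (punchIn v p) v ] + deg X-v p)
    ≡⟨ cong (deg X v +_) (∑-distrib-+ (λ p → [ adj X (punchIn v p) v ]) (deg X-v)) ⟩
  deg X v + (sum (λ p → [ adj X (punchIn v p) v ]) + sum (deg X-v))
    ≡⟨ cong (λ z → deg X v + (z + sum (deg X-v))) neighbours-of-v ⟩
  deg X v + (deg X v + sum (deg X-v))                    ≡⟨ cong (λ z → deg X v + (deg X v + z)) (handshake X-v) ⟨
  deg X v + (deg X v + (edges X-v + edges X-v))          ≡⟨ regroup (deg X v) (edges X-v) ⟩
  (edges X-v + deg X v) + (edges X-v + deg X v)          ∎)
  where
  open ≡-Reasoning
  X-v = delete X v
  neighbours-of-v : sum (λ p → [ adj X (punchIn v p) v ]) ≡ deg X v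
  neighbours-of-v = sym (trans (deg-punchIn X v v)
    (cong₂ _+_ (cong [_] (irrfl X v)) (sum-cong-≗ (λ p → cong [_] (Graph.sym X v (punchIn v p))))))
  regroup : ∀ d e → d + (d + (e + e)) ≡ (e + d) + (e + d)
  regroup = solve-∀

≅-deg : ∀ {N} (X Y : Graph N) ((π , _) : X ≅ Y) → ∀ i → deg X i ≡ deg Y (Inverse.to π i)
≅-deg X Y (π , π-adj) i =
  trans (sum-cong-≗ (λ j → cong [_] (π-adj i j))) (sym (sum-permute (λ y → [ adj Y (Inverse.to π i) y ]) π))

≅-edges : ∀ {N} (X Y : Graph N) → X ≅ Y → edges X ≡ edges Y
≅-edges X Y (π , π-adj) = double-injective _ _ (begin
  edges X + edges X                   ≡⟨ handshake X ⟩
  sum (deg X)                         ≡⟨ sum-cong-≗ (≅-deg X Y (π , π-adj)) ⟩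
  sum (λ i → deg Y (Inverse.to π i))  ≡⟨ sum-permute (deg Y) π ⟨
  sum (deg Y)                         ≡⟨ handshake Y ⟨
  edges Y + edges Y                   ∎)
  where open ≡-Reasoning

delete-≅⇒edges-balance : ∀ {n} (G H : Graph (suc n)) v w → delete G v ≅ delete H w →
  edges G + deg H w ≡ edges H + deg G v
delete-≅⇒edges-balance G H v w G-v≅H-w = begin
  edges G + deg H w                    ≡⟨ cong (_+ deg H w) (edges-delete G v) ⟩
  edges (delete G v) + deg G v + deg H w
    ≡⟨ cong (λ e → e + deg G v + deg H w) (≅-edges (delete G v) (delete H w) G-v≅H-w) ⟩
  edges (delete H w) + deg G v + deg H w ≡⟨ xy∙z≈xz∙y (edges (delete H w)) (deg G v) (deg H w) ⟩
  edges (delete H w) + deg H w + deg G v ≡⟨ cong (_+ deg G v) (edges-delete H w) ⟨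
  edges H + deg G v                    ∎
  where open ≡-Reasoning

irregular : ∀ {N} → Graph N → Fin N → Bool
irregular X x = isNo (deg X x ≟ℕ 2)

irregular-intro : ∀ {N} (X : Graph N) x → deg X x ≢ 2 → T (irregular X x)
irregular-intro X x = fromWitnessFalse {a? = deg X x ≟ℕ 2}

irregular-elim : ∀ {N} (X : Graph N) x → T (irregular X x) → deg X x ≢ 2
irregular-elim X x = toWitnessFalse {a? = deg X x ≟ℕ 2}

irregular-delete : ∀ {n} (X : Graph (suc n)) w →
  count (irregular (delete X w)) ≤ count (irregular X) + deg X w
irregular-delete X w = ≤-trans
  (count-≤-injection (irregular (delete X w)) (λ x → irregular X x ∨ adj X w x) (λ u _ → punchIn w u)
    (λ u u′ _ _ → punchIn-injective w u u′) irregular-or-neighbour)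
  (count-∨ (irregular X) (adj X w))
  where
  irregular-or-neighbour : ∀ u → T (irregular (delete X w) u) →
    T (irregular X (punchIn w u) ∨ adj X w (punchIn w u))
  irregular-or-neighbour u irr with adj X (punchIn w u) w in uw
  ... | true = Equivalence.from T-∨ (inj₂ (subst T (trans (sym uw) (Graph.sym X (punchIn w u) w)) tt))
  ... | false = Equivalence.from T-∨ (inj₁ (irregular-intro X (punchIn w u) λ deg≡2 →
                  irregular-elim (delete X w) u irr (trans (sym same-deg) deg≡2)))
    where
    same-deg : deg X (punchIn w u) ≡ deg (delete X w) u
    same-deg = trans (deg-delete X w u) (cong (λ b → [ b ] + deg (delete X w) u) uw)

bipartite-delete : ∀ {n} (X : Graph (suc n)) v → Bipartite X → Bipartite (delete X v)
bipartite-delete X v (c , proper) = (λ i → c (punchIn v i)) , (λ i j → proper (punchIn v i) (punchIn v j))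

≅-bipartite : ∀ {N} (X Y : Graph N) → X ≅ Y → Bipartite X → Bipartite Y
≅-bipartite X Y (π , π-adj) (c , proper) = (λ y → c (Inverse.from π y)) , λ i j ij →
  proper (Inverse.from π i) (Inverse.from π j) (subst T (sym (trans (π-adj _ _)
    (cong₂ (adj Y) (Inverse.strictlyInverseˡ π i) (Inverse.strictlyInverseˡ π j)))) ij)

ColourableWithout : ∀ {N} → Graph N → Fin N → Set
ColourableWithout {N} X w = Σ (Fin N → Bool) λ c → ∀ a b → T (adj X a b) → w ≢ a → w ≢ b → c a ≢ c b

bipartite-delete⇒colourableWithout : ∀ {n} (X : Graph (suc n)) w → Bipartite (delete X w) → ColourableWithout X w
bipartite-delete⇒colourableWithout X w (c , proper) = c′ , proper′
  where
  c′ : Fin _ → Bool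
  c′ x with w ≟ x
  ... | yes _ = false
  ... | no w≢x = c (punchOut w≢x)
  proper′ : ∀ a b → T (adj X a b) → w ≢ a → w ≢ b → c′ a ≢ c′ b
  proper′ a b ab w≢a w≢b with w ≟ a | w ≟ b
  ... | yes w≡a | _ = ⊥-elim (w≢a w≡a)
  ... | no _ | yes w≡b = ⊥-elim (w≢b w≡b)
  ... | no w≢a′ | no w≢b′ = proper (punchOut w≢a′) (punchOut w≢b′)
    (subst₂ (λ a b → T (adj X a b)) (sym (punchIn-punchOut w≢a′)) (sym (punchIn-punchOut w≢b′)) ab)

true≢false : true ≢ false
true≢false ()

odd : ℕ → Bool
odd zero = false
odd (suc n) = not (odd n)

odd-+ : ∀ a b → odd (a + b) ≡ odd a xor odd b
odd-+ zero b = refl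
odd-+ (suc a) b = trans (cong not (odd-+ a b)) (not-distribˡ-xor (odd a) (odd b))

odd-+1 : ∀ n → odd (n + 1) ≡ not (odd n)
odd-+1 n = trans (odd-+ n 1) (xor-comm (odd n) true)

odd-+2 : ∀ n → odd (n + 2) ≡ odd n
odd-+2 n = trans (odd-+ n 2) (xor-identityʳ (odd n))

ShortOdd : ℕ → ℕ → Set
ShortOdd k a = odd a ≡ true × a + 2 < k

long-summand⇒next≡1 : ∀ {a b c k} → a + b + c ≡ k → ¬ (a + 2 < k) → 1 ≤ b → 1 ≤ c → b ≡ 1
long-summand⇒next≡1 {a} {b} {c} refl a+2≮k 1≤b 1≤c =
  ≤-antisym (+-cancelˡ-≤ (a + 1) b 1 (begin
    a + 1 + b    ≡⟨ xy∙z≈xz∙y a 1 b ⟩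
    a + b + 1    ≤⟨ +-monoʳ-≤ (a + b) 1≤c ⟩
    a + b + c    ≤⟨ ≮⇒≥ a+2≮k ⟩
    a + 2        ≡⟨ +-assoc a 1 1 ⟨
    a + 1 + 1    ∎)) 1≤b
  where open ≤-Reasoning

-- An odd closed walk split at three points has an odd part that, closed up by two
-- extra edges, is still shorter than the whole walk.
short-odd-summand : ∀ {k} a b c → a + b + c ≡ k → 1 ≤ a → 1 ≤ b → 1 ≤ c → 3 < k → odd k ≡ true →
  ShortOdd k a ⊎ ShortOdd k b ⊎ ShortOdd k c
short-odd-summand {k} a b c sum≡k 1≤a 1≤b 1≤c 3<k odd-k with odd a in odd-a
... | true with a + 2 <? k
...   | yes a+2<k = inj₁ (refl , a+2<k)
...   | no a+2≮k = inj₂ (inj₁ (cong odd b≡1 , subst (λ b → b + 2 < k) (sym b≡1) 3<k))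
  where b≡1 = long-summand⇒next≡1 sum≡k a+2≮k 1≤b 1≤c
short-odd-summand {k} a b c sum≡k 1≤a 1≤b 1≤c 3<k odd-k | false with odd b in odd-b
... | true with b + 2 <? k
...   | yes b+2<k = inj₂ (inj₁ (refl , b+2<k))
...   | no b+2≮k = ⊥-elim (true≢false (trans (cong odd (sym a≡1)) odd-a))
  where a≡1 = long-summand⇒next≡1 (trans (cong (_+ c) (+-comm b a)) sum≡k) b+2≮k 1≤a 1≤c
short-odd-summand {k} a b c sum≡k 1≤a 1≤b 1≤c 3<k odd-k | false | false with odd c in odd-c
... | true with c + 2 <? k
...   | yes c+2<k = inj₂ (inj₂ (refl , c+2<k))
...   | no c+2≮k = ⊥-elim (true≢false (trans (cong odd (sym a≡1)) odd-a))
  where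
  rotate : ∀ a b c → c + a + b ≡ a + b + c
  rotate = solve-∀
  a≡1 = long-summand⇒next≡1 (trans (rotate a b c) sum≡k) c+2≮k 1≤a 1≤b
short-odd-summand {k} a b c sum≡k _ _ _ _ odd-k | false | false | false =
  ⊥-elim (true≢false (begin
    true                        ≡⟨ odd-k ⟨
    odd k                       ≡⟨ cong odd sum≡k ⟨
    odd (a + b + c)             ≡⟨ odd-+ (a + b) c ⟩
    odd (a + b) xor odd c       ≡⟨ cong (_xor odd c) (odd-+ a b) ⟩
    (odd a xor odd b) xor odd c ≡⟨ cong₂ _xor_ (cong₂ _xor_ odd-a odd-b) odd-c ⟩
    false                       ∎))
  where open ≡-Reasoning

suc-%-shift : ∀ i k → .{{_ : NonZero k}} → suc i % k ≡ suc (i % k) % k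
suc-%-shift i k = trans (cong (λ z → suc z % k) (m≡m%n+[m/n]*n i k)) ([m+kn]%n≡m%n (suc (i % k)) (i / k) k)

suc-% : ∀ i k → .{{_ : NonZero k}} → suc i % k ≡ suc (i % k) ⊎ suc i % k ≡ 0 × suc (i % k) ≡ k
suc-% i k with m≤n⇒m<n∨m≡n (m%n<n i k)
... | inj₁ r+1<k = inj₁ (trans (suc-%-shift i k) (m<n⇒m%n≡m r+1<k))
... | inj₂ r+1≡k = inj₂ (trans (suc-%-shift i k) (trans (cong (_% k) r+1≡k) (n%n≡0 k)) , r+1≡k)

module Walks {N : ℕ} (H : Graph N) where

  V : Set
  V = Fin N

  data Walk : V → V → Set where
    nil  : ∀ {x} → Walk x x
    cons : ∀ {x} y {z} → T (adj H x y) → Walk y z → Walk x z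

  length : ∀ {x y} → Walk x y → ℕ
  length nil = 0
  length (cons _ _ W) = suc (length W)

  _++ʷ_ : ∀ {x y z} → Walk x y → Walk y z → Walk x z
  nil ++ʷ W′ = W′
  cons y e W ++ʷ W′ = cons y e (W ++ʷ W′)

  length-++ʷ : ∀ {x y z} (W : Walk x y) (W′ : Walk y z) → length (W ++ʷ W′) ≡ length W + length W′
  length-++ʷ nil W′ = refl
  length-++ʷ (cons y e W) W′ = cong suc (length-++ʷ W W′)

  adj-sym : ∀ {x y} → T (adj H x y) → T (adj H y x)
  adj-sym {x} {y} = subst T (Graph.sym H x y)

  edge : ∀ {x y} → T (adj H x y) → Walk x y
  edge {y = y} e = cons y e nil

  reverse : ∀ {x y} → Walk x y → Walk y x
  reverse nil = nil
  reverse (cons y e W) = reverse W ++ʷ edge (adj-sym e)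

  length-reverse : ∀ {x y} (W : Walk x y) → length (reverse W) ≡ length W
  length-reverse nil = refl
  length-reverse (cons y e W) =
    trans (length-++ʷ (reverse W) _) (trans (+-comm (length (reverse W)) 1) (cong suc (length-reverse W)))

  length-subst-end : ∀ {x y y′} (p : y ≡ y′) (W : Walk x y) → length (subst (Walk x) p W) ≡ length W
  length-subst-end refl W = refl

  length-subst-start : ∀ {x x′ y} (p : x ≡ x′) (W : Walk x y) → length (subst (λ s → Walk s y) p W) ≡ length W
  length-subst-start refl W = refl

  OddClosedWalk : Set
  OddClosedWalk = Σ V λ x → Σ (Walk x x) λ W → odd (length W) ≡ true

  -- Colours are certified by walks from a root, so that a colouring conflict yields an odd closed walk.
  record PartialColouring (t : ℕ) : Set where
    field
      colour : V → Bool
      root   : V → V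
      walk   : ∀ x → Walk (root x) x
      walk-parity : ∀ x → odd (length (walk x)) ≡ colour x
      proper : ∀ x y → toℕ x < t → toℕ y < t → T (adj H x y) →
               colour y ≡ not (colour x) × root x ≡ root y

  trivial-colouring : PartialColouring 0
  trivial-colouring = record
    { colour = λ _ → false ; root = λ x → x ; walk = λ _ → nil
    ; walk-parity = λ _ → refl ; proper = λ _ _ () }

  module Extend (t : ℕ) (t<N : t < N) (C : PartialColouring t) where
    open PartialColouring C

    v : V
    v = fromℕ< t<N

    toℕ-v : toℕ v ≡ t
    toℕ-v = toℕ-fromℕ< t<N

    Neighbour : V → Set
    Neighbour a = toℕ a < t × T (adj H v a)

    neighbour? : ∀ a → Dec (Neighbour a)
    neighbour? a = (toℕ a <? t) ×-dec T? (adj H v a)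

    Conflict : Set
    Conflict = Σ V λ a → Σ V λ a′ →
      Neighbour a × Neighbour a′ × root a ≡ root a′ × colour a′ ≡ not (colour a)

    conflict? : Dec Conflict
    conflict? = any? λ a → any? λ a′ → neighbour? a ×-dec neighbour? a′ ×-dec (root a ≟ root a′)
                                        ×-dec (colour a′ ≟𝔹 not (colour a))

    conflict⇒odd : Conflict → OddClosedWalk
    conflict⇒odd (a , a′ , (_ , va) , (_ , va′) , same-root , colour-a′) = v , cons a va back , odd-W
      where
      walk-a′ = subst (λ s → Walk s a′) (sym same-root) (walk a′)
      back = reverse (walk a) ++ʷ (walk-a′ ++ʷ edge (adj-sym va′))
      odd-W : not (odd (length back)) ≡ true
      odd-W = begin
        not (odd (length back))
          ≡⟨ cong (λ l → not (odd l)) (trans (length-++ʷ (reverse (walk a)) _) (cong₂ _+_ (length-reverse (walk a))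
               (trans (length-++ʷ walk-a′ _) (cong (_+ 1) (length-subst-start (sym same-root) (walk a′)))))) ⟩
        not (odd (length (walk a) + (length (walk a′) + 1)))
          ≡⟨ cong not (trans (odd-+ (length (walk a)) _) (cong₂ _xor_ (walk-parity a)
               (trans (odd-+1 (length (walk a′))) (cong not (walk-parity a′))))) ⟩
        not (colour a xor not (colour a′))       ≡⟨ cong (λ c → not (colour a xor not c)) colour-a′ ⟩
        not (colour a xor not (not (colour a)))  ≡⟨ cong (λ c → not (colour a xor c)) (not-involutive (colour a)) ⟩
        not (colour a xor colour a)              ≡⟨ cong not (xor-same (colour a)) ⟩
        true                                     ∎
        where open ≡-Reasoning

    -- Without a conflict, v joins the components of its processed neighbours, which all
    -- share v as new root; the colour of a rerooted x is the parity of the walk v → a ⇝ root ⇝ x.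
    module NoConflict (no-conflict : ¬ Conflict) where
      data Status (x : V) : Set where
        is-v      : x ≡ v → Status x
        joined    : x ≢ v → (a : V) → Neighbour a → root a ≡ root x → Status x
        untouched : x ≢ v → (∀ a → Neighbour a → root a ≢ root x) → Status x

      status : ∀ x → Status x
      status x with x ≟ v | any? (λ a → neighbour? a ×-dec (root a ≟ root x))
      ... | yes x≡v | _ = is-v x≡v
      ... | no x≢v | yes (a , va , same-root) = joined x≢v a va same-root
      ... | no x≢v | no ¬joined = untouched x≢v (λ a va same-root → ¬joined (a , va , same-root))

      colourOf : ∀ x → Status x → Bool
      colourOf x (is-v _) = false
      colourOf x (joined _ a _ _) = not (colour x xor colour a)
      colourOf x (untouched _ _) = colour x

      rootOf : ∀ x → Status x → V
      rootOf x (is-v _) = v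
      rootOf x (joined _ _ _ _) = v
      rootOf x (untouched _ _) = root x

      walkOf : ∀ x → (s : Status x) → Walk (rootOf x s) x
      walkOf x (is-v x≡v) = subst (Walk v) (sym x≡v) nil
      walkOf x (joined _ a (_ , va) same-root) =
        cons a va (reverse (walk a) ++ʷ subst (λ s → Walk s x) (sym same-root) (walk x))
      walkOf x (untouched _ _) = walk x

      walkOf-parity : ∀ x (s : Status x) → odd (length (walkOf x s)) ≡ colourOf x s
      walkOf-parity x (is-v x≡v) = cong odd (length-subst-end (sym x≡v) nil)
      walkOf-parity x (joined _ a (_ , va) same-root) = begin
        not (odd (length (reverse (walk a) ++ʷ subst (λ s → Walk s x) (sym same-root) (walk x))))
          ≡⟨ cong (λ l → not (odd l)) (trans (length-++ʷ (reverse (walk a)) _)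
               (cong₂ _+_ (length-reverse (walk a)) (length-subst-start (sym same-root) (walk x)))) ⟩
        not (odd (length (walk a) + length (walk x)))
          ≡⟨ cong not (trans (odd-+ (length (walk a)) _) (cong₂ _xor_ (walk-parity a) (walk-parity x))) ⟩
        not (colour a xor colour x) ≡⟨ cong not (xor-comm (colour a) (colour x)) ⟩
        not (colour x xor colour a) ∎
        where open ≡-Reasoning
      walkOf-parity x (untouched _ _) = walk-parity x

      same-root⇒same-colour : ∀ a b → Neighbour a → Neighbour b → root a ≡ root b → colour b ≡ colour a
      same-root⇒same-colour a b va vb same-root =
        trans (¬-not (λ c → no-conflict (a , b , va , vb , same-root , c))) (not-involutive (colour a))

      status-v : (s : Status v) → colourOf v s ≡ false × rootOf v s ≡ v
      status-v (is-v _) = refl , refl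
      status-v (joined v≢v _ _ _) = ⊥-elim (v≢v refl)
      status-v (untouched v≢v _) = ⊥-elim (v≢v refl)

      below⇒≢v : ∀ {x} → toℕ x < t → x ≢ v
      below⇒≢v x<t x≡v = <-irrefl (trans (cong toℕ x≡v) toℕ-v) x<t

      status-neighbour : ∀ y (s : Status y) → Neighbour y → colourOf y s ≡ true × rootOf y s ≡ v
      status-neighbour y (is-v y≡v) (y<t , _) = ⊥-elim (below⇒≢v y<t y≡v)
      status-neighbour y (joined _ b vb same-root) vy =
        trans (cong (λ c → not (c xor colour b)) (same-root⇒same-colour b y vb vy same-root))
              (cong not (xor-same (colour b))) , refl
      status-neighbour y (untouched _ ¬joined) vy = ⊥-elim (¬joined y vy refl)

      proper-below : ∀ x y (s : Status x) (s′ : Status y) → toℕ x < t → toℕ y < t → T (adj H x y) →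
                     colourOf y s′ ≡ not (colourOf x s) × rootOf x s ≡ rootOf y s′
      proper-below x y (is-v x≡v) _ x<t _ _ = ⊥-elim (below⇒≢v x<t x≡v)
      proper-below x y _ (is-v y≡v) _ y<t _ = ⊥-elim (below⇒≢v y<t y≡v)
      proper-below x y (joined _ a va ra) (joined _ b vb rb) x<t y<t xy = (begin
        not (colour y xor colour b)        ≡⟨ cong (λ c → not (c xor colour b)) (proj₁ (proper x y x<t y<t xy)) ⟩
        not (not (colour x) xor colour b)  ≡⟨ cong (λ c → not (not (colour x) xor c)) same-colour ⟩
        not (not (colour x) xor colour a)  ≡⟨ cong not (not-distribˡ-xor (colour x) (colour a)) ⟨
        not (not (colour x xor colour a))  ∎) , refl
        where
        open ≡-Reasoning
        same-colour = same-root⇒same-colour a b va vb (trans ra (trans (proj₂ (proper x y x<t y<t xy)) (sym rb)))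
      proper-below x y (joined _ a va ra) (untouched _ ¬joined) x<t y<t xy =
        ⊥-elim (¬joined a va (trans ra (proj₂ (proper x y x<t y<t xy))))
      proper-below x y (untouched _ ¬joined) (joined _ b vb rb) x<t y<t xy =
        ⊥-elim (¬joined b vb (trans rb (sym (proj₂ (proper x y x<t y<t xy)))))
      proper-below x y (untouched _ _) (untouched _ _) x<t y<t xy = proper x y x<t y<t xy

      below-suc : ∀ x → toℕ x < suc t → toℕ x < t ⊎ x ≡ v
      below-suc x (s≤s x≤t) with m≤n⇒m<n∨m≡n x≤t
      ... | inj₁ x<t = inj₁ x<t
      ... | inj₂ x≡t = inj₂ (toℕ-injective (trans x≡t (sym toℕ-v)))

      colouring : PartialColouring (suc t)
      colouring = record
        { colour = λ x → colourOf x (status x)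
        ; root = λ x → rootOf x (status x)
        ; walk = λ x → walkOf x (status x)
        ; walk-parity = λ x → walkOf-parity x (status x)
        ; proper = proper′ }
        where
        proper′ : ∀ x y → toℕ x < suc t → toℕ y < suc t → T (adj H x y) →
                  colourOf y (status y) ≡ not (colourOf x (status x)) × rootOf x (status x) ≡ rootOf y (status y)
        proper′ x y x<t+1 y<t+1 xy with below-suc x x<t+1 | below-suc y y<t+1
        ... | inj₁ x<t | inj₁ y<t = proper-below x y (status x) (status y) x<t y<t xy
        ... | inj₂ refl | inj₂ refl = ⊥-elim (subst T (irrfl H x) xy)
        ... | inj₂ refl | inj₁ y<t =
          let (colour-y , root-y) = status-neighbour y (status y) (y<t , xy)
              (colour-v , root-v) = status-v (status v)
          in trans colour-y (cong not (sym colour-v)) , trans root-v (sym root-y)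
        ... | inj₁ x<t | inj₂ refl =
          let (colour-x , root-x) = status-neighbour x (status x) (x<t , adj-sym xy)
              (colour-v , root-v) = status-v (status v)
          in trans colour-v (cong not (sym colour-x)) , trans root-x (sym root-v)

    extend : OddClosedWalk ⊎ PartialColouring (suc t)
    extend with conflict?
    ... | yes conflict = inj₁ (conflict⇒odd conflict)
    ... | no no-conflict = inj₂ (NoConflict.colouring no-conflict)

  colour-below : ∀ t → t ≤ N → OddClosedWalk ⊎ PartialColouring t
  colour-below zero _ = inj₂ trivial-colouring
  colour-below (suc t) t<N with colour-below t (≤-trans (n≤1+n t) t<N)
  ... | inj₁ odd-walk = inj₁ odd-walk
  ... | inj₂ C = Extend.extend t t<N C

  ¬bipartite⇒oddClosedWalk : ¬ Bipartite H → OddClosedWalk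
  ¬bipartite⇒oddClosedWalk ¬bipartite with colour-below N ≤-refl
  ... | inj₁ odd-walk = odd-walk
  ... | inj₂ C = ⊥-elim (¬bipartite (colour , λ i j ij same →
          not-¬ (sym same) (proj₁ (proper i j (toℕ<n i) (toℕ<n j) ij))))
    where open PartialColouring C

  vertexAt : ∀ {x y} → Walk x y → ℕ → V
  vertexAt {x} nil i = x
  vertexAt {x} (cons y e W) zero = x
  vertexAt (cons y e W) (suc i) = vertexAt W i

  vertexAt-0 : ∀ {x y} (W : Walk x y) → vertexAt W 0 ≡ x
  vertexAt-0 nil = refl
  vertexAt-0 (cons y e W) = refl

  vertexAt-length : ∀ {x y} (W : Walk x y) → vertexAt W (length W) ≡ y
  vertexAt-length nil = refl
  vertexAt-length (cons y e W) = vertexAt-length W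

  vertexAt-adj : ∀ {x y} (W : Walk x y) i → i < length W → T (adj H (vertexAt W i) (vertexAt W (suc i)))
  vertexAt-adj (cons y e W) zero _ = subst (λ z → T (adj H _ z)) (sym (vertexAt-0 W)) e
  vertexAt-adj (cons y e W) (suc i) (s≤s i<l) = vertexAt-adj W i i<l

  -- Indexing by ℕ turns arcs that wrap around the closed walk into ordinary segments.
  record PeriodicOddWalk : Set where
    field
      k : ℕ
      C : ℕ → V
      C-adj : ∀ i → T (adj H (C i) (C (suc i)))
      C-periodic : ∀ i → C (k + i) ≡ C i
      k-odd : odd k ≡ true

  unroll : ((x , W , _) : OddClosedWalk) → Σ PeriodicOddWalk λ P → PeriodicOddWalk.k P ≡ length W
  unroll (x , W , odd-W) with length W in l≡
  ... | suc k′ = record { k = suc k′ ; C = C ; C-adj = C-adj ; C-periodic = C-periodic ; k-odd = odd-W } , refl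
    where
    C : ℕ → V
    C i = vertexAt W (i % suc k′)
    step : ∀ i → T (adj H (C i) (vertexAt W (suc (i % suc k′))))
    step i = vertexAt-adj W (i % suc k′) (subst (i % suc k′ <_) (sym l≡) (m%n<n i (suc k′)))
    C-adj : ∀ i → T (adj H (C i) (C (suc i)))
    C-adj i with suc-% i (suc k′)
    ... | inj₁ wraps-not = subst (λ j → T (adj H (C i) (vertexAt W j))) (sym wraps-not) (step i)
    ... | inj₂ (wraps , at-end) = subst (λ j → T (adj H (C i) (vertexAt W j))) (sym wraps)
            (subst (λ z → T (adj H (C i) z))
              (trans (cong (vertexAt W) (trans at-end (sym l≡))) (trans (vertexAt-length W) (sym (vertexAt-0 W))))
              (step i))
    C-periodic : ∀ i → C (suc k′ + i) ≡ C i
    C-periodic i = cong (vertexAt W) (trans (cong (_% suc k′) (+-comm (suc k′) i)) ([m+n]%n≡m%n i (suc k′)))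

  -- C (k ∸ 1 + j) is the predecessor of C j on the cycle.
  record Tight (P : PeriodicOddWalk) : Set where
    open PeriodicOddWalk P
    field
      no-backtrack : ∀ (j : Fin k) → C (k ∸ 1 + toℕ j) ≢ C (suc (toℕ j))
      no-three-neighbours : 3 < k → ∀ x (p q s : Fin k) → toℕ p < toℕ q → toℕ q < toℕ s →
        T (adj H x (C (toℕ p))) → T (adj H x (C (toℕ q))) → T (adj H x (C (toℕ s))) → ⊥

  ShorterThan : ℕ → Set
  ShorterThan k = Σ OddClosedWalk λ (_ , W , _) → length W < k

  module Shortcuts (P : PeriodicOddWalk) where
    open PeriodicOddWalk P

    segment : ∀ α l → Walk (C α) (C (l + α))
    segment α zero = nil
    segment α (suc l) = cons (C (suc α)) (C-adj α) (subst (Walk _) (cong C (+-suc l α)) (segment (suc α) l))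

    length-segment : ∀ α l → length (segment α l) ≡ l
    length-segment α zero = refl
    length-segment α (suc l) =
      cong suc (trans (length-subst-end (cong C (+-suc l α)) (segment (suc α) l)) (length-segment (suc α) l))

    3≤k : 3 ≤ k
    3≤k = lower-bound k k-odd (C-periodic 0) (C-adj 0)
      where
      lower-bound : ∀ k → odd k ≡ true → C (k + 0) ≡ C 0 → T (adj H (C 0) (C 1)) → 3 ≤ k
      lower-bound 1 _ C1≡C0 C0C1 = ⊥-elim (subst T (irrfl H (C 0)) (subst (λ z → T (adj H (C 0) z)) C1≡C0 C0C1))
      lower-bound (suc (suc (suc _))) _ _ _ = s≤s (s≤s (s≤s z≤n))

    backtrack⇒shorter : ∀ j → C (k ∸ 1 + j) ≡ C (suc j) → ShorterThan k
    backtrack⇒shorter j back = (C (suc j) , W , odd-W) , length-W<k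
      where
      k∸2+j+1 : k ∸ 2 + suc j ≡ k ∸ 1 + j
      k∸2+j+1 with k | 3≤k
      ... | suc (suc k′) | _ = +-suc k′ j
      ... | 1 | s≤s ()
      W = subst (Walk _) (trans (cong C k∸2+j+1) back) (segment (suc j) (k ∸ 2))
      length-W : length W ≡ k ∸ 2
      length-W = trans (length-subst-end _ (segment (suc j) (k ∸ 2))) (length-segment (suc j) (k ∸ 2))
      odd-W : odd (length W) ≡ true
      odd-W = trans (cong odd length-W)
        (trans (sym (odd-+2 (k ∸ 2))) (trans (cong odd (m∸n+n≡m (≤-trans (s≤s (s≤s z≤n)) 3≤k))) k-odd))
      length-W<k : length W < k
      length-W<k = subst (_< k) (sym length-W) (∸-monoʳ-< {k} {2} {0} (s≤s z≤n) (≤-trans (s≤s (s≤s z≤n)) 3≤k))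

    detour : ∀ x α β l → l + α ≡ β → T (adj H x (C α)) → T (adj H x (C β)) → odd l ≡ true → l + 2 < k →
             ShorterThan k
    detour x α β l l+α≡β xCα xCβ odd-l l+2<k = (x , W , odd-W) , subst (_< k) (sym length-W) l+2<k
      where
      Cβx = adj-sym (subst (λ z → T (adj H x (C z))) (sym l+α≡β) xCβ)
      W = cons (C α) xCα (segment α l ++ʷ edge Cβx)
      length-W : length W ≡ l + 2
      length-W = trans (cong suc (trans (length-++ʷ (segment α l) (edge Cβx)) (cong (_+ 1) (length-segment α l))))
                       (trans (cong suc (+-comm l 1)) (+-comm 2 l))
      odd-W = trans (cong odd length-W) (trans (odd-+2 l) odd-l)

    -- The three arcs between p < q < s have total length k; a short odd one gives a detour.
    three-neighbours⇒shorter : 3 < k → ∀ x (p q s : Fin k) → toℕ p < toℕ q → toℕ q < toℕ s →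
      T (adj H x (C (toℕ p))) → T (adj H x (C (toℕ q))) → T (adj H x (C (toℕ s))) → ShorterThan k
    three-neighbours⇒shorter 3<k x p q s p<q q<s xCp xCq xCs = detour-along
      (short-odd-summand (q′ ∸ p′) (s′ ∸ q′) (k + p′ ∸ s′) arcs-sum
        (m<n⇒0<n∸m p<q) (m<n⇒0<n∸m q<s) (m<n⇒0<n∸m s′<k+p′) 3<k k-odd)
      where
      p′ = toℕ p
      q′ = toℕ q
      s′ = toℕ s
      s′<k+p′ = ≤-trans (toℕ<n s) (m≤m+n k p′)
      arcs-sum : q′ ∸ p′ + (s′ ∸ q′) + (k + p′ ∸ s′) ≡ k
      arcs-sum = +-cancelʳ-≡ p′ _ _ (begin
        q′ ∸ p′ + (s′ ∸ q′) + (k + p′ ∸ s′) + p′  ≡⟨ regroup (q′ ∸ p′) (s′ ∸ q′) (k + p′ ∸ s′) p′ ⟩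
        k + p′ ∸ s′ + (s′ ∸ q′ + (q′ ∸ p′ + p′))  ≡⟨ cong (λ z → k + p′ ∸ s′ + (s′ ∸ q′ + z)) (m∸n+n≡m (<⇒≤ p<q)) ⟩
        k + p′ ∸ s′ + (s′ ∸ q′ + q′)              ≡⟨ cong (k + p′ ∸ s′ +_) (m∸n+n≡m (<⇒≤ q<s)) ⟩
        k + p′ ∸ s′ + s′                          ≡⟨ m∸n+n≡m (<⇒≤ s′<k+p′) ⟩
        k + p′                                    ∎)
        where
        open ≡-Reasoning
        regroup : ∀ a b c d → a + b + c + d ≡ c + (b + (a + d))
        regroup = solve-∀
      detour-along : ShortOdd k (q′ ∸ p′) ⊎ ShortOdd k (s′ ∸ q′) ⊎ ShortOdd k (k + p′ ∸ s′) → ShorterThan k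
      detour-along (inj₁ (odd-pq , short)) =
        detour x p′ q′ (q′ ∸ p′) (m∸n+n≡m (<⇒≤ p<q)) xCp xCq odd-pq short
      detour-along (inj₂ (inj₁ (odd-qs , short))) =
        detour x q′ s′ (s′ ∸ q′) (m∸n+n≡m (<⇒≤ q<s)) xCq xCs odd-qs short
      detour-along (inj₂ (inj₂ (odd-sp , short))) =
        detour x s′ (k + p′) (k + p′ ∸ s′) (m∸n+n≡m (<⇒≤ s′<k+p′)) xCs
          (subst (λ z → T (adj H x z)) (sym (C-periodic p′)) xCp) odd-sp short

    tight-or-shorter : Tight P ⊎ ShorterThan k
    tight-or-shorter with any? (λ (j : Fin k) → C (k ∸ 1 + toℕ j) ≟ C (suc (toℕ j)))
    ... | yes (j , back) = inj₂ (backtrack⇒shorter (toℕ j) back)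
    ... | no ¬back with 3 <? k
    ...   | no k≤3 = inj₁ (record { no-backtrack = λ j back → ¬back (j , back)
                                  ; no-three-neighbours = λ 3<k → ⊥-elim (k≤3 3<k) })
    ...   | yes 3<k with three?
      where
      three? = any? λ x → any? λ p → any? λ q → any? λ s →
        (toℕ p <? toℕ q) ×-dec (toℕ q <? toℕ s) ×-dec
        T? (adj H x (C (toℕ p))) ×-dec T? (adj H x (C (toℕ q))) ×-dec T? (adj H x (C (toℕ s)))
    ...     | yes (x , p , q , s , p<q , q<s , xCp , xCq , xCs) =
      inj₂ (three-neighbours⇒shorter 3<k x p q s p<q q<s xCp xCq xCs)
    ...     | no ¬three = inj₁ (record
      { no-backtrack = λ j back → ¬back (j , back)
      ; no-three-neighbours = λ _ x p q s p<q q<s xCp xCq xCs →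
          ¬three (x , p , q , s , p<q , q<s , xCp , xCq , xCs) })

  tighten : ∀ fuel ((_ , W , _) : OddClosedWalk) → length W < fuel → Σ PeriodicOddWalk Tight
  tighten (suc fuel) o l<fuel with unroll o
  ... | P , k≡l with Shortcuts.tight-or-shorter P
  ...   | inj₁ tight = P , tight
  ...   | inj₂ (o′ , l′<k) = tighten fuel o′ (≤-trans l′<k (subst (_≤ fuel) (sym k≡l) (≤-pred l<fuel)))

  ¬bipartite⇒tight : ¬ Bipartite H → Σ PeriodicOddWalk Tight
  ¬bipartite⇒tight ¬bipartite = tighten _ (¬bipartite⇒oddClosedWalk ¬bipartite) ≤-refl

module TightCycle {N : ℕ} (H : Graph N) (P : Walks.PeriodicOddWalk H) (tight : Walks.Tight H P) where
  open Walks H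
  open PeriodicOddWalk P
  open Tight tight
  open Shortcuts P using (3≤k)

  instance
    k-nonZero : NonZero k
    k-nonZero = >-nonZero (≤-trans (s≤s z≤n) 3≤k)

  onCycle? : ∀ x → Dec (∃ λ (j : Fin k) → C (toℕ j) ≡ x)
  onCycle? x = any? (λ j → C (toℕ j) ≟ x)

  onCycle : V → Bool
  onCycle x = isYes (onCycle? x)

  position : ∀ {x} → T (onCycle x) → Fin k
  position {x} x∈C = proj₁ (toWitness {a? = onCycle? x} x∈C)

  C-position : ∀ {x} (x∈C : T (onCycle x)) → C (toℕ (position x∈C)) ≡ x
  C-position {x} x∈C = proj₂ (toWitness {a? = onCycle? x} x∈C)

  C-%k : ∀ t → C (t % k) ≡ C t
  C-%k t = begin
    C (t % k)                ≡⟨ C-multiple (t / k) (t % k) ⟨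
    C (t / k * k + t % k)    ≡⟨ cong C (+-comm (t / k * k) (t % k)) ⟩
    C (t % k + t / k * k)    ≡⟨ cong C (m≡m%n+[m/n]*n t k) ⟨
    C t                      ∎
    where
    open ≡-Reasoning
    C-multiple : ∀ q i → C (q * k + i) ≡ C i
    C-multiple zero i = refl
    C-multiple (suc q) i = trans (cong C (+-assoc k (q * k) i)) (trans (C-periodic (q * k + i)) (C-multiple q i))

  C-onCycle : ∀ t → T (onCycle (C t))
  C-onCycle t = fromWitness {a? = onCycle? (C t)} (fromℕ< (m%n<n t k) , trans (cong C (toℕ-fromℕ< _)) (C-%k t))

  -- Otherwise the colouring would alternate all along the odd closed walk.
  colourableWithout⇒onCycle : ∀ x → ColourableWithout H x → T (onCycle x)
  colourableWithout⇒onCycle x (c , proper) with onCycle? x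
  ... | yes _ = tt
  ... | no x∉C = ⊥-elim (not-¬ refl (begin
    c (C 0)               ≡⟨ cong c (C-periodic 0) ⟨
    c (C (k + 0))         ≡⟨ cong (c ∘ C) (+-identityʳ k) ⟩
    c (C k)               ≡⟨ colour-along k ⟩
    c (C 0) xor odd k     ≡⟨ cong (c (C 0) xor_) k-odd ⟩
    c (C 0) xor true      ≡⟨ xor-comm (c (C 0)) true ⟩
    not (c (C 0))         ∎))
    where
    open ≡-Reasoning
    x≢C : ∀ t → x ≢ C t
    x≢C t x≡Ct = x∉C (fromℕ< (m%n<n t k) , trans (cong C (toℕ-fromℕ< _)) (trans (C-%k t) (sym x≡Ct)))
    colour-along : ∀ t → c (C t) ≡ c (C 0) xor odd t
    colour-along zero = sym (xor-identityʳ (c (C 0)))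
    colour-along (suc t) = begin
      c (C (suc t))             ≡⟨ ¬-not (λ same → proper _ _ (C-adj t) (x≢C t) (x≢C (suc t)) (sym same)) ⟩
      not (c (C t))             ≡⟨ cong not (colour-along t) ⟩
      not (c (C 0) xor odd t)   ≡⟨ xor-not (c (C 0)) (odd t) ⟩
      c (C 0) xor not (odd t)   ∎
      where
      xor-not : ∀ a b → not (a xor b) ≡ a xor not b
      xor-not false b = refl
      xor-not true b = refl

  cycleDeg : V → ℕ
  cycleDeg x = count (λ y → adj H x y ∧ onCycle y)

  offCycle : V → Bool
  offCycle x = not (onCycle x)

  offCycleDeg : V → ℕ
  offCycleDeg x = count (λ y → adj H x y ∧ offCycle y)

  deg≡cycleDeg+offCycleDeg : ∀ x → deg H x ≡ cycleDeg x + offCycleDeg x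
  deg≡cycleDeg+offCycleDeg x = count-split (adj H x) onCycle

  cycleDeg≤2 : 3 < k → ∀ x → cycleDeg x ≤ 2
  cycleDeg≤2 3<k x = ≤-trans
    (count-≤-injection (λ y → adj H x y ∧ onCycle y) (λ j → adj H x (C (toℕ j)))
      (λ y xy∈C → position (∧-proj₂ xy∈C))
      (λ y y′ xy∈C xy′∈C same → trans (sym (C-position (∧-proj₂ xy∈C)))
                                  (trans (cong (C ∘ toℕ) same) (C-position (∧-proj₂ xy′∈C))))
      (λ y xy∈C → subst (λ z → T (adj H x z)) (sym (C-position (∧-proj₂ xy∈C))) (∧-proj₁ xy∈C)))
    (count≤2 _ (no-three-neighbours 3<k x))

  2≤cycleDeg : ∀ (j : Fin k) → 2 ≤ cycleDeg (C (toℕ j))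
  2≤cycleDeg j = 2≤count _ (C (suc (toℕ j))) (C (k ∸ 1 + toℕ j)) (λ next≡prev → no-backtrack j (sym next≡prev))
    (∧-intro (C-adj (toℕ j)) (C-onCycle _)) (∧-intro C-prev (C-onCycle _))
    where
    C-prev : T (adj H (C (toℕ j)) (C (k ∸ 1 + toℕ j)))
    C-prev = adj-sym (subst (λ z → T (adj H (C (k ∸ 1 + toℕ j)) z))
               (trans (cong (λ l → C (l + toℕ j)) (suc-pred k)) (C-periodic (toℕ j))) (C-adj (k ∸ 1 + toℕ j)))

  cycleDeg≡2 : 3 < k → ∀ x → T (onCycle x) → cycleDeg x ≡ 2
  cycleDeg≡2 3<k x x∈C =
    ≤-antisym (cycleDeg≤2 3<k x) (subst (λ z → 2 ≤ cycleDeg z) (C-position x∈C) (2≤cycleDeg (position x∈C)))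

  r : ℕ
  r = count offCycle

  -- Double counting of the edges from irregular cycle vertices to vertices off the cycle.
  irregular-onCycle≤2r : 3 < k → count (λ x → onCycle x ∧ irregular H x) ≤ r + r
  irregular-onCycle≤2r 3<k = begin
    count (λ x → onCycle x ∧ irregular H x)  ≤⟨ sum-mono-≤ _ _ leaves-cycle ⟩
    sum (λ x → count (λ y → crossing x y))  ≡⟨ ∑-comm (λ x y → [ crossing x y ]) ⟩
    sum (λ y → count (λ x → crossing x y))  ≤⟨ sum-mono-≤ _ _ enters-off-cycle ⟩
    sum (λ y → [ offCycle y ] + [ offCycle y ])  ≡⟨ ∑-distrib-+ (λ y → [ offCycle y ]) (λ y → [ offCycle y ]) ⟩
    r + r                                    ∎
    where
    open ≤-Reasoning
    crossing : V → V → Bool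
    crossing x y = onCycle x ∧ (adj H x y ∧ offCycle y)
    crossing-onCycle : ∀ {x y} → T (crossing x y) → T (onCycle x)
    crossing-onCycle {x} {y} = ∧-proj₁ {onCycle x} {adj H x y ∧ offCycle y}
    crossing-adj : ∀ {x y} → T (crossing x y) → T (adj H x y)
    crossing-adj {x} {y} = ∧-proj₁ {adj H x y} {offCycle y} ∘ ∧-proj₂ {onCycle x}
    crossing-offCycle : ∀ {x y} → T (crossing x y) → T (offCycle y)
    crossing-offCycle {x} {y} = ∧-proj₂ {adj H x y} {offCycle y} ∘ ∧-proj₂ {onCycle x}
    leaves-cycle : ∀ x → [ onCycle x ∧ irregular H x ] ≤ count (λ y → crossing x y)
    leaves-cycle x with onCycle x in x∈C | irregular H x in irr
    ... | false | _ = z≤n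
    ... | true | false = z≤n
    ... | true | true with offCycleDeg x in off≡
    ...   | suc _ = s≤s z≤n
    ...   | zero = ⊥-elim (toWitnessFalse {a? = deg H x ≟ℕ 2} (subst T (sym irr) tt) (begin-equality
            deg H x                       ≡⟨ deg≡cycleDeg+offCycleDeg x ⟩
            cycleDeg x + offCycleDeg x    ≡⟨ cong₂ _+_ (cycleDeg≡2 3<k x (subst T (sym x∈C) tt)) off≡ ⟩
            2                             ∎))
    enters-off-cycle : ∀ y → count (λ x → crossing x y) ≤ [ offCycle y ] + [ offCycle y ]
    enters-off-cycle y = bound (onCycle y) refl
      where
      bound : ∀ b → onCycle y ≡ b → count (λ x → crossing x y) ≤ [ not b ] + [ not b ]
      bound true y∈C = ≤-reflexive (count≡0 (λ x → crossing x y)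
                         (λ x cross → subst T (cong not y∈C) (crossing-offCycle cross)))
      bound false _ = ≤-trans (count-mono (λ x → crossing x y) (λ x → adj H y x ∧ onCycle x)
                                (λ x cross → ∧-intro (adj-sym (crossing-adj cross)) (crossing-onCycle cross)))
                              (cycleDeg≤2 3<k y)

  irregular≤3r : 3 < k → count (irregular H) ≤ r + r + r
  irregular≤3r 3<k = begin
    count (irregular H)                                     ≤⟨ count-mono (irregular H) _ split ⟩
    count (λ x → (onCycle x ∧ irregular H x) ∨ offCycle x)  ≤⟨ count-∨ (λ x → onCycle x ∧ irregular H x) offCycle ⟩
    count (λ x → onCycle x ∧ irregular H x) + r             ≤⟨ +-monoˡ-≤ r (irregular-onCycle≤2r 3<k) ⟩
    r + r + r                                               ∎
    where
    open ≤-Reasoning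
    split : ∀ x → T (irregular H x) → T ((onCycle x ∧ irregular H x) ∨ offCycle x)
    split x irr with onCycle x
    ... | true = Equivalence.from (T-∨ {irregular H x} {false}) (inj₁ irr)
    ... | false = tt

module Hypomorphic {n m : ℕ} (G H : Graph (suc n)) (bipartite-G : Bipartite G)
  (v w : Fin m → Fin (suc n)) (v-inj : Injective _≡_ _≡_ v) (w-inj : Injective _≡_ _≡_ w)
  (G-v≅H-w : ∀ i → delete G (v i) ≅ delete H (w i))
  (P : Walks.PeriodicOddWalk H) (tight : Walks.Tight H P) where

  open Walks H using (PeriodicOddWalk)
  open PeriodicOddWalk P using (k; C)
  open TightCycle H P tight

  w-onCycle : ∀ i → T (onCycle (w i))
  w-onCycle i = colourableWithout⇒onCycle (w i) (bipartite-delete⇒colourableWithout H (w i)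
    (≅-bipartite (delete G (v i)) (delete H (w i)) (G-v≅H-w i) (bipartite-delete G (v i) bipartite-G)))

  m≤cycleSize : m ≤ count onCycle
  m≤cycleSize = subst (_≤ count onCycle) (count-true m)
    (count-≤-injection (λ _ → true) onCycle (λ i _ → w i) (λ i j _ _ → w-inj) (λ i _ → w-onCycle i))

  cycleSize≤k : count onCycle ≤ k
  cycleSize≤k = subst (count onCycle ≤_) (count-true k)
    (count-≤-injection onCycle (λ _ → true) (λ _ x∈C → position x∈C)
      (λ x y x∈C y∈C same → trans (sym (C-position x∈C)) (trans (cong (C ∘ toℕ) same) (C-position y∈C)))
      (λ _ _ → tt))

  r+m≤N : r + m ≤ suc n
  r+m≤N = begin
    r + m                  ≤⟨ +-monoʳ-≤ r m≤cycleSize ⟩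
    r + count onCycle      ≡⟨ +-comm r (count onCycle) ⟩
    count onCycle + r      ≡⟨ count+count-not onCycle ⟩
    suc n                  ∎
    where open ≤-Reasoning

  irregular-w≤2r : 3 < k → count (λ i → irregular H (w i)) ≤ r + r
  irregular-w≤2r 3<k = ≤-trans
    (count-≤-injection (λ i → irregular H (w i)) (λ x → onCycle x ∧ irregular H x) (λ i _ → w i)
      (λ i j _ _ → w-inj) (λ i irr → ∧-intro (w-onCycle i) irr))
    (irregular-onCycle≤2r 3<k)

  module Unbalanced (3<k : 3 < k) (5r+12≤m : 5 * r + 12 ≤ m) (edges≢ : edges G ≢ edges H) where

    balance : ∀ i → edges G + deg H (w i) ≡ edges H + deg G (v i)
    balance i = delete-≅⇒edges-balance G H (v i) (w i) (G-v≅H-w i)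

    regular : Fin m → Bool
    regular i = isYes (deg H (w i) ≟ℕ 2)

    regular+irregular : count regular + count (λ i → irregular H (w i)) ≡ m
    regular+irregular = count+count-not regular

    some-regular : ∃ λ i → T (regular i)
    some-regular with count regular in count≡
    ... | suc _ = 0<count⇒∃ regular (subst (0 <_) (sym count≡) (s≤s z≤n))
    ... | zero = ⊥-elim (m+1+n≰m (r + r) (begin
      r + r + 12             ≤⟨ +-monoʳ-≤ (r + r) (m≤n+m 12 (3 * r)) ⟩
      r + r + (3 * r + 12)   ≡⟨ collect r ⟩
      5 * r + 12             ≤⟨ 5r+12≤m ⟩
      m                      ≡⟨ regular+irregular ⟨
      count regular + count (λ i → irregular H (w i))  ≡⟨ cong (_+ count (λ i → irregular H (w i))) count≡ ⟩
      count (λ i → irregular H (w i))  ≤⟨ irregular-w≤2r 3<k ⟩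
      r + r                  ∎))
      where
      open ≤-Reasoning
      collect : ∀ x → x + x + (3 * x + 12) ≡ 5 * x + 12
      collect = solve-∀

    i₀ : Fin m
    i₀ = proj₁ some-regular

    v₀ w₀ : Fin (suc n)
    v₀ = v i₀
    w₀ = w i₀

    a : ℕ
    a = deg G v₀

    deg-w₀ : deg H w₀ ≡ 2
    deg-w₀ = toWitness {a? = deg H w₀ ≟ℕ 2} (proj₂ some-regular)

    a≢2 : a ≢ 2
    a≢2 a≡2 = edges≢ (+-cancelʳ-≡ 2 _ _ (begin
      edges G + 2         ≡⟨ cong (edges G +_) deg-w₀ ⟨
      edges G + deg H w₀  ≡⟨ balance i₀ ⟩
      edges H + a         ≡⟨ cong (edges H +_) a≡2 ⟩
      edges H + 2         ∎))
      where open ≡-Reasoning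

    regular⇒deg≡a : ∀ j → T (regular j) → deg G (v j) ≡ a
    regular⇒deg≡a j reg = +-cancelˡ-≡ (edges H) _ _ (begin
      edges H + deg G (v j)  ≡⟨ balance j ⟨
      edges G + deg H (w j)  ≡⟨ cong (edges G +_) (trans (toWitness {a? = deg H (w j) ≟ℕ 2} reg) (sym deg-w₀)) ⟩
      edges G + deg H w₀     ≡⟨ balance i₀ ⟩
      edges H + a            ∎)
      where open ≡-Reasoning

    isI₀ : Fin m → Bool
    isI₀ j = isYes (j ≟ i₀)

    other : Fin m → Bool
    other j = regular j ∧ not (isI₀ j)

    regular≤1+other : count regular ≤ 1 + count other
    regular≤1+other = ≤-trans (≤-reflexive (count-split regular isI₀)) (+-monoˡ-≤ (count other)
      (count≤1 (λ j → regular j ∧ isI₀ j) λ j j′ j<j′ j≡i₀ j′≡i₀ →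
        <-irrefl (cong toℕ (trans (toWitness {a? = j ≟ i₀} (∧-proj₂ {regular j} j≡i₀))
                                  (sym (toWitness {a? = j′ ≟ i₀} (∧-proj₂ {regular j′} j′≡i₀))))) j<j′))

    v₀≢v : ∀ j → T (other j) → v₀ ≢ v j
    v₀≢v j oth v₀≡vj = toWitnessFalse {a? = j ≟ i₀} (∧-proj₂ {regular j} oth) (sym (v-inj v₀≡vj))

    deg-G-v₀ : ∀ j (oth : T (other j)) → deg (delete G v₀) (punchOut (v₀≢v j oth)) ≡ a ∸ [ adj G (v j) v₀ ]
    deg-G-v₀ j oth = sym (begin
      a ∸ [ adj G (v j) v₀ ]      ≡⟨ cong (_∸ [ adj G (v j) v₀ ]) (sym (regular⇒deg≡a j (∧-proj₁ oth))) ⟩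
      deg G (v j) ∸ [ adj G (v j) v₀ ]
        ≡⟨ cong (_∸ [ adj G (v j) v₀ ]) (subst (λ x → deg G x ≡ [ adj G x v₀ ] + deg (delete G v₀) u)
             (punchIn-punchOut (v₀≢v j oth)) (deg-delete G v₀ u)) ⟩
      [ adj G (v j) v₀ ] + deg (delete G v₀) u ∸ [ adj G (v j) v₀ ]  ≡⟨ m+n∸m≡n [ adj G (v j) v₀ ] _ ⟩
      deg (delete G v₀) u         ∎)
      where
      open ≡-Reasoning
      u = punchOut (v₀≢v j oth)

    stays2 : Fin m → Bool
    stays2 j = isYes (a ∸ [ adj G (v j) v₀ ] ≟ℕ 2)

    -- Since a ≢ 2, the degree can only become 2 after deleting v₀ if a ≡ 3 and v j ∼ v₀.
    stays2⇒ : ∀ j → T (stays2 j) → adj G (v j) v₀ ≡ true × a ≡ 3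
    stays2⇒ j st = lemma a (adj G (v j) v₀) (toWitness {a? = a ∸ [ adj G (v j) v₀ ] ≟ℕ 2} st) a≢2
      where
      lemma : ∀ a b → a ∸ [ b ] ≡ 2 → a ≢ 2 → b ≡ true × a ≡ 3
      lemma a false a≡2 a≢2 = ⊥-elim (a≢2 a≡2)
      lemma (suc a) true a∸1≡2 _ = refl , cong suc a∸1≡2

    other-stays2≤3 : count (λ j → other j ∧ stays2 j) ≤ 3
    other-stays2≤3 with a ≟ℕ 3
    ... | no a≢3 = ≤-reflexive′ (count≡0 _ λ j oth-st → a≢3 (proj₂ (stays2⇒ j (∧-proj₂ {other j} oth-st))))
      where
      ≤-reflexive′ : ∀ {x} → x ≡ 0 → x ≤ 3
      ≤-reflexive′ refl = z≤n
    ... | yes a≡3 = begin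
      count (λ j → other j ∧ stays2 j)   ≤⟨ count-mono _ (λ j → adj G v₀ (v j)) v₀-neighbour ⟩
      count (λ j → adj G v₀ (v j))
        ≤⟨ count-≤-injection _ (adj G v₀) (λ j _ → v j) (λ _ _ _ _ → v-inj) (λ _ v₀vj → v₀vj) ⟩
      a                                  ≡⟨ a≡3 ⟩
      3                                  ∎
      where
      open ≤-Reasoning
      v₀-neighbour : ∀ j → T (other j ∧ stays2 j) → T (adj G v₀ (v j))
      v₀-neighbour j oth-st =
        subst T (trans (sym (proj₁ (stays2⇒ j (∧-proj₂ {other j} oth-st)))) (Graph.sym G (v j) v₀)) tt

    other-drops≤irregular : count (λ j → other j ∧ not (stays2 j)) ≤ count (irregular (delete H w₀))
    other-drops≤irregular = count-≤-injection (λ j → other j ∧ not (stays2 j)) (irregular (delete H w₀))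
      image image-injective image-irregular
      where
      π = proj₁ (G-v≅H-w i₀)
      u : ∀ j → T (other j ∧ not (stays2 j)) → Fin n
      u j oth-dr = punchOut (v₀≢v j (∧-proj₁ oth-dr))
      image : ∀ j → T (other j ∧ not (stays2 j)) → Fin n
      image j oth-dr = Inverse.to π (u j oth-dr)
      image-injective : ∀ j j′ oth-dr oth-dr′ → image j oth-dr ≡ image j′ oth-dr′ → j ≡ j′
      image-injective j j′ oth-dr oth-dr′ same =
        v-inj (punchOut-injective (v₀≢v j (∧-proj₁ oth-dr)) (v₀≢v j′ (∧-proj₁ oth-dr′))
        (trans (sym (Inverse.strictlyInverseʳ π (u j oth-dr)))
          (trans (cong (Inverse.from π) same) (Inverse.strictlyInverseʳ π (u j′ oth-dr′)))))
      image-irregular : ∀ j oth-dr → T (irregular (delete H w₀) (image j oth-dr))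
      image-irregular j oth-dr = irregular-intro (delete H w₀) (image j oth-dr) λ deg≡2 →
        toWitnessFalse {a? = a ∸ [ adj G (v j) v₀ ] ≟ℕ 2} (∧-proj₂ {other j} oth-dr) (begin
          a ∸ [ adj G (v j) v₀ ]                    ≡⟨ deg-G-v₀ j (∧-proj₁ oth-dr) ⟨
          deg (delete G v₀) (u j oth-dr)            ≡⟨ ≅-deg (delete G v₀) (delete H w₀) (G-v≅H-w i₀) (u j oth-dr) ⟩
          deg (delete H w₀) (image j oth-dr)        ≡⟨ deg≡2 ⟩
          2                                         ∎)
        where open ≡-Reasoning

    absurd : ⊥
    absurd = m+1+n≰m (5 * r + 6) (begin
      5 * r + 6 + 6                                          ≡⟨ +-assoc (5 * r) 6 6 ⟩
      5 * r + 12                                             ≤⟨ 5r+12≤m ⟩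
      m                                                      ≡⟨ regular+irregular ⟨
      count regular + count (λ i → irregular H (w i))        ≤⟨ +-mono-≤ regular≤1+other (irregular-w≤2r 3<k) ⟩
      1 + count other + (r + r)                              ≡⟨ cong (λ c → 1 + c + (r + r)) (count-split other stays2) ⟩
      1 + (count (λ j → other j ∧ stays2 j) + count (λ j → other j ∧ not (stays2 j))) + (r + r)
        ≤⟨ +-monoˡ-≤ (r + r) (+-monoʳ-≤ 1 (+-mono-≤ other-stays2≤3 other-drops≤irregular)) ⟩
      1 + (3 + count (irregular (delete H w₀))) + (r + r)
        ≤⟨ +-monoˡ-≤ (r + r) (+-monoʳ-≤ 1 (+-monoʳ-≤ 3 (irregular-delete H w₀))) ⟩
      1 + (3 + (count (irregular H) + deg H w₀)) + (r + r)
        ≤⟨ +-monoˡ-≤ (r + r) (+-monoʳ-≤ 1 (+-monoʳ-≤ 3 (+-mono-≤ (irregular≤3r 3<k) (≤-reflexive deg-w₀)))) ⟩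
      1 + (3 + (r + r + r + 2)) + (r + r)                     ≡⟨ collect r ⟩
      5 * r + 6                                              ∎)
      where
      open ≤-Reasoning
      collect : ∀ x → 1 + (3 + (x + x + x + 2)) + (x + x) ≡ 5 * x + 6
      collect = solve-∀

  edges≡edges : 3 < k → 5 * r + 12 ≤ m → edges G ≡ edges H
  edges≡edges 3<k 5r+12≤m = decidable-stable (edges G ≟ℕ edges H) (Unbalanced.absurd 3<k 5r+12≤m)

3≤N⇒3<m : ∀ {N m} → 3 ≤ N → 5 * N + 12 ≤ 6 * m → 3 < m
3≤N⇒3<m {N} {m} 3≤N bound with 3 <? m
... | yes 3<m = 3<m
... | no m≤3 = ⊥-elim (m+1+n≰m 18 (begin
  27            ≤⟨ +-monoˡ-≤ 12 (*-monoʳ-≤ 5 3≤N) ⟩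
  5 * N + 12    ≤⟨ bound ⟩
  6 * m         ≤⟨ *-monoʳ-≤ 6 (≮⇒≥ m≤3) ⟩
  18            ∎))
  where open ≤-Reasoning

r+m≤N⇒5r+12≤m : ∀ {N m r} → r + m ≤ N → 5 * N + 12 ≤ 6 * m → 5 * r + 12 ≤ m
r+m≤N⇒5r+12≤m {N} {m} {r} r+m≤N bound = +-cancelʳ-≤ (5 * m) _ _ (begin
  5 * r + 12 + 5 * m     ≡⟨ collect r m ⟩
  5 * (r + m) + 12       ≤⟨ +-monoˡ-≤ 12 (*-monoʳ-≤ 5 r+m≤N) ⟩
  5 * N + 12             ≤⟨ bound ⟩
  6 * m                  ≡⟨ split-off m ⟩
  m + 5 * m              ∎)
  where
  open ≤-Reasoning
  collect : ∀ r m → 5 * r + 12 + 5 * m ≡ 5 * (r + m) + 12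
  collect = solve-∀
  split-off : ∀ m → 6 * m ≡ m + 5 * m
  split-off = solve-∀

lemma10 : (n : ℕ) → 3 ≤ suc n →
    (G H : Graph (suc n)) → Bipartite G → ¬ Bipartite H →
    (m : ℕ) → 5 * suc n + 12 ≤ 6 * m →
    (v w : Fin m → Fin (suc n)) → Injective _≡_ _≡_ v → Injective _≡_ _≡_ w →
    (∀ i → delete G (v i) ≅ delete H (w i)) →
    edgeCount G ≡ edgeCount H
lemma10 n 3≤N G H bipartite-G ¬bipartite-H m bound v w v-inj w-inj G-v≅H-w = begin
  edgeCount G  ≡⟨ edgeCount≡edges G ⟩
  edges G      ≡⟨ edges≡edges 3<k (r+m≤N⇒5r+12≤m r+m≤N bound) ⟩
  edges H      ≡⟨ edgeCount≡edges H ⟨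
  edgeCount H  ∎
  where
  open ≡-Reasoning
  tight-cycle : Σ (Walks.PeriodicOddWalk H) (Walks.Tight H)
  tight-cycle = Walks.¬bipartite⇒tight H ¬bipartite-H
  open Hypomorphic G H bipartite-G v w v-inj w-inj G-v≅H-w (proj₁ tight-cycle) (proj₂ tight-cycle)
  open TightCycle H (proj₁ tight-cycle) (proj₂ tight-cycle) using (r)
  3<k : 3 < Walks.PeriodicOddWalk.k (proj₁ tight-cycle)
  3<k = ≤-trans (3≤N⇒3<m 3≤N bound) (≤-trans m≤cycleSize cycleSize≤k)
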